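{- Let $b>1$ be an odd integer and let $w$ be the infinite smooth word over $\{1,b\}$ with $\Phi(w)=(1b)^\omega$. Then every block of $b$'s in $w$ has length $1$.
   Context: For a word $w$ over $\{1,b\}$ written as maximal blocks $\alpha_0^{i_0}\alpha_1^{i_1}\cdots$ ($\alpha_{k+1}\ne\alpha_k$, $i_k\ge1$), $\Delta(w)=i_0i_1\cdots$. An infinite word $w\in\{1,b\}^\omega$ is smooth if $\Delta^k(w)\in\{1,b\}^\omega$ for all $k\ge0$. For an infinite smooth word $w$, $\Phi(w)=\Delta^0(w)[0]\,\Delta^1(w)[0]\,\Delta^2(w)[0]\cdots$ (the sequence of first letters of the iterates); $\Phi$ is a bijection from infinite smooth words over $\{1,b\}$ onto $\{1,b\}^\omega$. A block is a maximal factor of the form $\alpha^k$ with $\alpha$ a letter. -}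

module Defs where

open import Data.Nat using (ℕ; zero; suc; _∸_; _≤_; _<_)
open import Data.Product using (Σ; ∃; _×_)
open import Data.Sum using (_⊎_)
open import Relation.Binary.PropositionalEquality using (_≡_; _≢_)

Word : Set
Word = ℕ → ℕ

OverAlphabet : ℕ → Word → Set
OverAlphabet b w = ∀ n → (w n ≡ 1) ⊎ (w n ≡ b)

-- Decomposition of w into its maximal blocks: block k occupies positions
-- [p k, p (k+1)); consecutive blocks carry different letters.
record Runs (w : Word) : Set where
  field
    p      : ℕ → ℕ
    p0     : p 0 ≡ 0
    incr   : ∀ k → p k < p (suc k)
    const  : ∀ k i → p k ≤ i → i < p (suc k) → w i ≡ w (p k)
    change : ∀ k → w (p (suc k)) ≢ w (p k)

IsΔ : Word → Word → Set
IsΔ w v = Σ (Runs w) λ r → ∀ k → v k ≡ Runs.p r (suc k) ∸ Runs.p r k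

-- W is the sequence of iterates Δ^k(w), each an infinite word over {1,b}.
-- (Δ is deterministic, so such W exists iff w is smooth, and then it is unique.)
SmoothIterates : ℕ → Word → (ℕ → Word) → Set
SmoothIterates b w W =
  (W 0 ≡ w) × (∀ k → OverAlphabet b (W k)) × (∀ k → IsΔ (W k) (W (suc k)))

Φ : (ℕ → Word) → Word
Φ W k = W k 0

alt1b : ℕ → Word
alt1b b zero = 1
alt1b b (suc zero) = b
alt1b b (suc (suc k)) = alt1b b k

IsBlock : Word → ℕ → ℕ → ℕ → Set
IsBlock w α i j =
  (i ≤ j) ×
  (∀ n → i ≤ n → n ≤ j → w n ≡ α) ×
  ((i ≡ 0) ⊎ (∃ λ i' → (suc i' ≡ i) × (w i' ≢ α))) ×
  (w (suc j) ≢ α)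

-- Since 1 and b are odd, all block lengths of Δ^k(w) are odd, so the j-th block
-- of Δ^k(w) starts at a position of the parity of j; and as Φ(w) = (1b)^ω, that
-- block carries the letter b exactly when j + k is odd.  Hence, by strong induction
-- on the position m, a b at position m of Δ^k(w) has m + k odd: if m is not the
-- start of its block j, that block has length b, i.e. Δ^(k+1)(w) has a b at j < m,
-- and the induction hypothesis makes j + k + 1 odd, contradicting j + k odd.
-- With k = 0, two adjacent b's in w would both sit at odd positions.
module Submission where

open import Defs
open import Data.Nat using (ℕ; _<_; _%_)
open import Relation.Binary.PropositionalEquality using (_≡_)

open import Data.Nat using (zero; suc; _+_; _≤_; z≤n; _<?_; parity)
open import Data.Nat.Properties
open import Data.Nat.Induction using (<-rec)
open import Data.Parity.Base using (1ℙ) renaming (_+_ to _+ℙ_)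
open import Data.Parity.Properties using (+-homo-+)
open import Data.Product using (∃-syntax; _×_; _,_; proj₁; proj₂)
open import Data.Sum using (_⊎_; inj₁; inj₂; [_,_]′)
open import Relation.Nullary using (yes; no; contradiction)
open import Relation.Binary.PropositionalEquality
  using (_≢_; refl; sym; trans; cong; cong₂; subst; subst₂; module ≡-Reasoning)

parity-odd : ∀ n → n % 2 ≡ 1 → parity n ≡ 1ℙ
parity-odd (suc zero)    _     = refl
parity-odd (suc (suc n)) n%2≡1 = parity-odd n n%2≡1

parity[1+n]≢parity[n] : ∀ n → parity (suc n) ≢ parity n
parity[1+n]≢parity[n] zero          ()
parity[1+n]≢parity[n] (suc zero)    ()
parity[1+n]≢parity[n] (suc (suc n)) = parity[1+n]≢parity[n] n

alt1b-next : ∀ {b x} n → (x ≡ 1) ⊎ (x ≡ b) → x ≢ alt1b b n → x ≡ alt1b b (suc n)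
alt1b-next zero          (inj₁ x≡1) x≢1 = contradiction x≡1 x≢1
alt1b-next zero          (inj₂ x≡b) _   = x≡b
alt1b-next (suc zero)    (inj₁ x≡1) _   = x≡1
alt1b-next (suc zero)    (inj₂ x≡b) x≢b = contradiction x≡b x≢b
alt1b-next (suc (suc n)) x∈αβ      x≢  = alt1b-next n x∈αβ x≢

alt1b≡b⇒odd : ∀ {b} → 1 ≢ b → ∀ n → alt1b b n ≡ b → parity n ≡ 1ℙ
alt1b≡b⇒odd 1≢b zero          1≡b = contradiction 1≡b 1≢b
alt1b≡b⇒odd 1≢b (suc zero)    _   = refl
alt1b≡b⇒odd 1≢b (suc (suc n)) eq  = alt1b≡b⇒odd 1≢b n eq

letters-odd : ∀ {b w} → parity b ≡ 1ℙ → OverAlphabet b w → ∀ n → parity (w n) ≡ 1ℙ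
letters-odd b-odd over n with over n
... | inj₁ wn≡1 = cong parity wn≡1
... | inj₂ wn≡b = trans (cong parity wn≡b) b-odd

module RunsProperties {w : Word} (r : Runs w) where
  open Runs r

  n≤p : ∀ n → n ≤ p n
  n≤p zero    = z≤n
  n≤p (suc n) = ≤-<-trans (n≤p n) (incr n)

  locate : ∀ m → ∃[ j ] p j ≤ m × m < p (suc j)
  locate zero = 0 , subst (_≤ 0) (sym p0) z≤n , subst (_< p 1) p0 (incr 0)
  locate (suc m) with locate m
  ... | j , pj≤m , m<pj' with suc m <? p (suc j)
  ... | yes 1+m<pj' = j , m≤n⇒m≤1+n pj≤m , 1+m<pj'
  ... | no  1+m≮pj' = suc j , ≤-reflexive pj'≡1+m , subst (_< p (suc (suc j))) pj'≡1+m (incr (suc j))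
    where pj'≡1+m : p (suc j) ≡ suc m
          pj'≡1+m = ≤-antisym (≮⇒≥ 1+m≮pj') m<pj'

  block-letters : ∀ {b} n → OverAlphabet b w → w 0 ≡ alt1b b n → ∀ j → w (p j) ≡ alt1b b (j + n)
  block-letters n over w0 zero = trans (cong w p0) w0
  block-letters n over w0 (suc j) =
    alt1b-next (j + n) (over (p (suc j))) (λ eq → change j (trans eq (sym (block-letters n over w0 j))))

module IsΔProperties {w v : Word} (Δ : IsΔ w v) where
  open Runs (proj₁ Δ)

  p-suc : ∀ j → p (suc j) ≡ p j + v j
  p-suc j = trans (sym (m+[n∸m]≡n (<⇒≤ (incr j)))) (cong (p j +_) (sym (proj₂ Δ j)))

  parity-p : (∀ j → parity (v j) ≡ 1ℙ) → ∀ j → parity (p j) ≡ parity j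
  parity-p v-odd zero = cong parity p0
  parity-p v-odd (suc j) = begin
    parity (p (suc j))           ≡⟨ cong parity (p-suc j) ⟩
    parity (p j + v j)           ≡⟨ +-homo-+ (p j) (v j) ⟩
    parity (p j) +ℙ parity (v j) ≡⟨ cong₂ _+ℙ_ (parity-p v-odd j) (v-odd j) ⟩
    parity j +ℙ 1ℙ               ≡⟨ sym (+-homo-+ j 1) ⟩
    parity (j + 1)               ≡⟨ cong parity (+-comm j 1) ⟩
    parity (suc j)               ∎
    where open ≡-Reasoning

  interior⇒1<v : ∀ {j m} → p j < m → m < p (suc j) → 1 < v j
  interior⇒1<v {j} pj<m m<pj' =
    +-cancelˡ-< (p j) 1 (v j) (subst₂ _<_ (+-comm 1 (p j)) (p-suc j) (≤-<-trans pj<m m<pj'))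

module _ {b : ℕ} (1≢b : 1 ≢ b) (b-odd : parity b ≡ 1ℙ) {W : ℕ → Word}
         (over : ∀ k → OverAlphabet b (W k)) (Δ : ∀ k → IsΔ (W k) (W (suc k)))
         (Φ≡alt : ∀ k → Φ W k ≡ alt1b b k) where

  b-at-odd-position : ∀ m k → W k m ≡ b → parity (m + k) ≡ 1ℙ
  b-at-odd-position = <-rec _ step
    where
    step : ∀ m → (∀ {i} → i < m → ∀ k → W k i ≡ b → parity (i + k) ≡ 1ℙ) →
           ∀ k → W k m ≡ b → parity (m + k) ≡ 1ℙ
    step m ih k Wkm≡b with RunsProperties.locate (proj₁ (Δ k)) m
    ... | j , pj≤m , m<pj' = [ inside-block , block-start ]′ (m≤n⇒m<n∨m≡n pj≤m)
      where
      open Runs (proj₁ (Δ k))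
      open RunsProperties (proj₁ (Δ k))
      open IsΔProperties (Δ k)
      open ≡-Reasoning

      j+k-odd : parity (j + k) ≡ 1ℙ
      j+k-odd = alt1b≡b⇒odd 1≢b (j + k) (begin
        alt1b b (j + k) ≡⟨ sym (block-letters k (over k) (Φ≡alt k) j) ⟩
        W k (p j)       ≡⟨ sym (const j m pj≤m m<pj') ⟩
        W k m           ≡⟨ Wkm≡b ⟩
        b               ∎)

      block-start : p j ≡ m → parity (m + k) ≡ 1ℙ
      block-start pj≡m = begin
        parity (m + k)           ≡⟨ cong (λ x → parity (x + k)) (sym pj≡m) ⟩
        parity (p j + k)         ≡⟨ +-homo-+ (p j) k ⟩
        parity (p j) +ℙ parity k ≡⟨ cong (_+ℙ parity k) (parity-p (letters-odd b-odd (over (suc k))) j) ⟩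
        parity j +ℙ parity k     ≡⟨ sym (+-homo-+ j k) ⟩
        parity (j + k)           ≡⟨ j+k-odd ⟩
        1ℙ                       ∎

      inside-block : p j < m → parity (m + k) ≡ 1ℙ
      inside-block pj<m = contradiction (trans j+1+k-odd (sym j+k-odd)) (parity[1+n]≢parity[n] (j + k))
        where
        Wk'j≡b : W (suc k) j ≡ b
        Wk'j≡b with over (suc k) j
        ... | inj₂ eq = eq
        ... | inj₁ eq = contradiction (subst (1 <_) eq (interior⇒1<v pj<m m<pj')) (<-irrefl refl)
        j+1+k-odd : parity (suc (j + k)) ≡ 1ℙ
        j+1+k-odd = subst (λ x → parity x ≡ 1ℙ) (+-suc j k) (ih (≤-<-trans (n≤p j) pj<m) (suc k) Wk'j≡b)

lemma25 : (b : ℕ) → 1 < b → b % 2 ≡ 1 →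
    (w : Word) (W : ℕ → Word) → SmoothIterates b w W →
    (∀ k → Φ W k ≡ alt1b b k) →
    ∀ i j → IsBlock w b i j → i ≡ j
lemma25 b 1<b b%2≡1 w W (W0≡w , over , Δ) Φ≡alt i j (i≤j , block , _ , _) with m≤n⇒m<n∨m≡n i≤j
... | inj₂ i≡j = i≡j
... | inj₁ i<j = contradiction (trans (odd (n≤1+n i) i<j) (sym (odd ≤-refl i≤j))) (parity[1+n]≢parity[n] i)
  where
  odd : ∀ {n} → i ≤ n → n ≤ j → parity n ≡ 1ℙ
  odd {n} i≤n n≤j = subst (λ x → parity x ≡ 1ℙ) (+-identityʳ n)
    (b-at-odd-position (<⇒≢ 1<b) (parity-odd b b%2≡1) over Δ Φ≡alt n 0
      (trans (cong (λ u → u n) W0≡w) (block n i≤n n≤j)))
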